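{- Let $n\ge 2$ and let $W[1..n]$ be positive weights, with van Leeuwen signature $S=\mathcal S(W)$. Then: the number of occurrences of $E$ in $S$ is $n$; the number of occurrences of $I$ in $S$ is $n-1$; $|S|=2n-1$; $S$ starts with $EE$; $S$ ends with $I$; the number of occurrences of the substring $EI$ in $S$ equals the number of occurrences of the substring $IE$ in $S$ plus one; and the number of occurrences of the substring $EI$ in $S$ lies in $[1..n-1]$.
   Context: Van Leeuwen's algorithm on $n\ge 2$ positive weights: sort the weights into a queue of external nodes; keep a second, initially empty, queue of internal nodes in creation order; repeatedly remove the minimum-weight node among the fronts of the two queues twice and append to the internal queue a new internal node whose weight is the sum of the two removed weights, until a single node (the root) remains, which is removed last. Ties between an external and an internal node are resolved in favor of the external node. The van Leeuwen signature $\mathcal S(W)\in\{E,I\}^{2n-1}$ is the string recording, for each node removed in this process (including the final root), whether it was external ($E$) or internal ($I$).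
   Formalization: The weights $W[1..n]$ are positive rationals. -}

module Defs where

open import Data.Nat using (ℕ; zero; suc)
open import Data.Bool using (Bool; true; false; if_then_else_; _∧_)
open import Data.List using (List; []; _∷_; length; filter; _++_; [_])
open import Data.Maybe using (Maybe; just; nothing)
open import Data.Product using (_×_; _,_)
open import Data.Rational using (ℚ; _+_; _≤?_)
open import Data.Rational.Properties using (≤-decTotalOrder)
open import Relation.Nullary.Decidable using (does)
open import Data.Vec using (Vec; toList)

open import Data.List.Sort ≤-decTotalOrder using (sort)

-- Node labels: external (E) or internal (I).
data Lbl : Set where
  E I : Lbl

pick : List ℚ → List ℚ → Maybe (Lbl × ℚ × List ℚ × List ℚ)
pick []       []       = nothing
pick (x ∷ xs) []       = just (E , x , xs , [])
pick []       (y ∷ ys) = just (I , y , [] , ys)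
pick (x ∷ xs) (y ∷ ys) =
  if does (x ≤? y) then just (E , x , xs , y ∷ ys)
                   else just (I , y , x ∷ xs , ys)

go : ℕ → List ℚ → List ℚ → List Lbl
go zero ext int with pick ext int
... | nothing = []
... | just (l , _ , _ , _) = [ l ]
go (suc k) ext int with pick ext int
... | nothing = []
... | just (l₁ , w₁ , ext₁ , int₁) with pick ext₁ int₁
...   | nothing = [ l₁ ]
...   | just (l₂ , w₂ , ext₂ , int₂) =
          l₁ ∷ l₂ ∷ go k ext₂ (int₂ ++ [ w₁ + w₂ ])

signature : ∀ {n} → Vec ℚ (suc n) → List Lbl
signature {n} W = go n (sort (toList W)) []

_=ˡ_ : Lbl → Lbl → Bool
E =ˡ E = true
I =ˡ I = true
_ =ˡ _ = false

count : Lbl → List Lbl → ℕ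
count l []       = 0
count l (x ∷ xs) = if l =ˡ x then suc (count l xs) else count l xs

count2 : Lbl → Lbl → List Lbl → ℕ
count2 a b []           = 0
count2 a b (x ∷ [])     = 0
count2 a b (x ∷ y ∷ xs) =
  if (a =ˡ x) ∧ (b =ˡ y) then suc (count2 a b (y ∷ xs)) else count2 a b (y ∷ xs)

-- Each removal takes a node from the queue named by its label, so the
-- signature has one E per weight and one I per merge; since the initial
-- internal queue is empty the first two removals are external, and the root
-- is a merged node, so the last removal is internal. A word of the form
-- E … I alternates between maximal E-blocks and I-blocks, so it has exactly
-- one more EI than IE, and each EI is followed by a distinct I.
module Submission where

open import Defs
open import Data.Nat using (ℕ; zero; suc; _+_; _≤_; z≤n; s≤s)
open import Data.Nat.Properties
  using (+-suc; +-comm; +-identityʳ; suc-injective; m+1+n≢0; m≤n+m; m≤n⇒m≤1+n; ≤-trans; ≤-reflexive)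
open import Data.Nat.Tactic.RingSolver using (solve-∀)
open import Data.Bool using (true; false; if_then_else_)
open import Data.Vec using (Vec; lookup; toList)
open import Data.Vec.Properties using (length-toList)
open import Data.List using (List; []; _∷_; length; last; [_]; _∷ʳ_)
open import Data.List.Properties using (length-++)
open import Data.Maybe using (just; nothing)
open import Data.Product using (_×_; _,_; ∃; map; map₂)
open import Data.Rational using (ℚ; Positive; _≤?_)
import Data.Rational as Q
open import Data.Rational.Properties using (≤-decTotalOrder)
open import Data.List.Sort ≤-decTotalOrder using (sort; sort-↭)
open import Data.List.Relation.Binary.Permutation.Propositional.Properties using (↭-length)
open import Relation.Nullary.Decidable using (does)
open import Relation.Nullary using (contradiction)
open import Relation.Binary.PropositionalEquality
  using (_≡_; _≢_; refl; sym; trans; cong; cong₂; subst; module ≡-Reasoning)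

δ : Lbl → Lbl → ℕ
δ a b = if a =ˡ b then 1 else 0

count-∷ : ∀ a l xs → count a (l ∷ xs) ≡ δ a l + count a xs
count-∷ a l xs with a =ˡ l
... | true  = refl
... | false = refl

length≡count-E+count-I : ∀ xs → length xs ≡ count E xs + count I xs
length≡count-E+count-I []       = refl
length≡count-E+count-I (E ∷ xs) = cong suc (length≡count-E+count-I xs)
length≡count-E+count-I (I ∷ xs) = trans (cong suc (length≡count-E+count-I xs)) (sym (+-suc _ _))

count2-EI+δ-last≡count2-IE+δ-head : ∀ h xs t →
  count2 E I (h ∷ xs ∷ʳ t) + δ E t ≡ count2 I E (h ∷ xs ∷ʳ t) + δ E h
count2-EI+δ-last≡count2-IE+δ-head E []       E = refl
count2-EI+δ-last≡count2-IE+δ-head E []       I = refl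
count2-EI+δ-last≡count2-IE+δ-head I []       E = refl
count2-EI+δ-last≡count2-IE+δ-head I []       I = refl
count2-EI+δ-last≡count2-IE+δ-head E (E ∷ xs) t = count2-EI+δ-last≡count2-IE+δ-head E xs t
count2-EI+δ-last≡count2-IE+δ-head E (I ∷ xs) t =
  trans (cong suc (trans (count2-EI+δ-last≡count2-IE+δ-head I xs t) (+-identityʳ _))) (+-comm 1 _)
count2-EI+δ-last≡count2-IE+δ-head I (E ∷ xs) t =
  trans (count2-EI+δ-last≡count2-IE+δ-head E xs t) (trans (+-comm _ 1) (sym (+-identityʳ _)))
count2-EI+δ-last≡count2-IE+δ-head I (I ∷ xs) t = count2-EI+δ-last≡count2-IE+δ-head I xs t

count2-EI≤count-I : ∀ x xs → count2 E I (x ∷ xs) ≤ count I xs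
count2-EI≤count-I x []       = z≤n
count2-EI≤count-I E (E ∷ xs) = count2-EI≤count-I E xs
count2-EI≤count-I E (I ∷ xs) = s≤s (count2-EI≤count-I I xs)
count2-EI≤count-I I (E ∷ xs) = count2-EI≤count-I E xs
count2-EI≤count-I I (I ∷ xs) = m≤n⇒m≤1+n (count2-EI≤count-I I xs)

last-∷ʳ : ∀ {A : Set} (xs : List A) x → last (xs ∷ʳ x) ≡ just x
last-∷ʳ []           x = refl
last-∷ʳ (_ ∷ [])     x = refl
last-∷ʳ (_ ∷ y ∷ ys) x = last-∷ʳ (y ∷ ys) x

pick-nothing : ∀ ext int → pick ext int ≡ nothing → length ext + length int ≡ 0
pick-nothing []      []      _ = refl
pick-nothing (x ∷ _) []      ()
pick-nothing []      (y ∷ _) ()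
pick-nothing (x ∷ _) (y ∷ _) eq with does (x ≤? y)
pick-nothing (x ∷ _) (y ∷ _) () | true
pick-nothing (x ∷ _) (y ∷ _) () | false

pick-just : ∀ ext int {l w ext′ int′} → pick ext int ≡ just (l , w , ext′ , int′) →
  length ext ≡ δ E l + length ext′ × length int ≡ δ I l + length int′
pick-just (x ∷ _) []      refl = refl , refl
pick-just []      (y ∷ _) refl = refl , refl
pick-just (x ∷ _) (y ∷ _) eq with does (x ≤? y)
pick-just (x ∷ _) (y ∷ _) refl | true  = refl , refl
pick-just (x ∷ _) (y ∷ _) refl | false = refl , refl

pick-size : ∀ ext int {l w ext′ int′} → pick ext int ≡ just (l , w , ext′ , int′) →
  length ext + length int ≡ suc (length ext′ + length int′)
pick-size (x ∷ _)  []       refl = refl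
pick-size []       (y ∷ _)  refl = refl
pick-size (x ∷ xs) (y ∷ ys) eq with does (x ≤? y)
pick-size (x ∷ xs) (y ∷ ys) refl | true  = refl
pick-size (x ∷ xs) (y ∷ ys) refl | false = +-suc (length (x ∷ xs)) (length ys)

record Merge (k : ℕ) (ext int : List ℚ) : Set where
  field
    first second : Lbl
    ext′ int′    : List ℚ
    merged       : ℚ
    unfold       : go (suc k) ext int ≡ first ∷ second ∷ go k ext′ (int′ ∷ʳ merged)
    length-ext   : length ext ≡ δ E first + (δ E second + length ext′)
    length-int   : length int ≡ δ I first + (δ I second + length int′)
    size-after   : length ext + length int ≡ suc (suc (length ext′ + length int′))

  rest : List Lbl
  rest = go k ext′ (int′ ∷ʳ merged)

  size-rest : length ext + length int ≡ suc (suc k) → length ext′ + length (int′ ∷ʳ merged) ≡ suc k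
  size-rest size = begin
    length ext′ + length (int′ ∷ʳ merged)  ≡⟨ cong (length ext′ +_) (trans (length-++ int′) (+-comm _ 1)) ⟩
    length ext′ + suc (length int′)        ≡⟨ +-suc _ _ ⟩
    suc (length ext′ + length int′)        ≡⟨ suc-injective (trans (sym size-after) size) ⟩
    suc k                                  ∎
    where open ≡-Reasoning

  count-unfold : ∀ a → count a (go (suc k) ext int) ≡ δ a first + (δ a second + count a rest)
  count-unfold a = begin
    count a (go (suc k) ext int)                ≡⟨ cong (count a) unfold ⟩
    count a (first ∷ second ∷ rest)             ≡⟨ count-∷ a first (second ∷ rest) ⟩
    δ a first + count a (second ∷ rest)         ≡⟨ cong (δ a first +_) (count-∷ a second rest) ⟩
    δ a first + (δ a second + count a rest)     ∎
    where open ≡-Reasoning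

go-unfold : ∀ k ext int {l₁ w₁ ext₁ int₁ l₂ w₂ ext₂ int₂} →
  pick ext int ≡ just (l₁ , w₁ , ext₁ , int₁) → pick ext₁ int₁ ≡ just (l₂ , w₂ , ext₂ , int₂) →
  go (suc k) ext int ≡ l₁ ∷ l₂ ∷ go k ext₂ (int₂ ∷ʳ (w₁ Q.+ w₂))
go-unfold k ext int eq₁ eq₂ rewrite eq₁ | eq₂ = refl

go-merge : ∀ k ext int → length ext + length int ≡ suc (suc k) → Merge k ext int
go-merge k ext int size with pick ext int in eq₁
... | nothing = contradiction (trans (sym size) (pick-nothing ext int eq₁)) λ ()
... | just (l₁ , w₁ , ext₁ , int₁) with pick ext₁ int₁ in eq₂
...   | nothing = contradiction (trans (suc-injective (trans (sym size) (pick-size ext int eq₁)))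
                                       (pick-nothing ext₁ int₁ eq₂)) λ ()
...   | just (l₂ , w₂ , ext₂ , int₂)
  with pick-just ext int eq₁ | pick-just ext₁ int₁ eq₂
...   | ext₁-length , int₁-length | ext₂-length , int₂-length = record
  { first = l₁ ; second = l₂ ; ext′ = ext₂ ; int′ = int₂ ; merged = w₁ Q.+ w₂
  ; unfold = go-unfold k ext int eq₁ eq₂
  ; length-ext = trans ext₁-length (cong (δ E l₁ +_) ext₂-length)
  ; length-int = trans int₁-length (cong (δ I l₁ +_) int₂-length)
  ; size-after = trans (pick-size ext int eq₁) (cong suc (pick-size ext₁ int₁ eq₂))
  }

nonempty-queues-size≢1 : ∀ x (ext : List ℚ) y (int : List ℚ) → length (x ∷ ext) + length (y ∷ int) ≢ 1
nonempty-queues-size≢1 x ext y int size = m+1+n≢0 (length ext) (suc-injective size)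

go-count-E : ∀ k ext int → length ext + length int ≡ suc k → count E (go k ext int) ≡ length ext
go-count-E zero    (_ ∷ [])    []          _    = refl
go-count-E zero    []          (_ ∷ [])    _    = refl
go-count-E zero    (x ∷ ext)   (y ∷ int)   size = contradiction size (nonempty-queues-size≢1 x ext y int)
go-count-E zero    (_ ∷ _ ∷ _) []          ()
go-count-E zero    []          (_ ∷ _ ∷ _) ()
go-count-E (suc k) ext         int         size = begin
  count E (go (suc k) ext int)           ≡⟨ count-unfold E ⟩
  δ E first + (δ E second + count E rest)
    ≡⟨ cong (λ c → δ E first + (δ E second + c)) (go-count-E k ext′ _ (size-rest size)) ⟩
  δ E first + (δ E second + length ext′)  ≡⟨ sym length-ext ⟩
  length ext                              ∎
  where
  open Merge (go-merge k ext int size)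
  open ≡-Reasoning

go-count-I : ∀ k ext int → length ext + length int ≡ suc k → count I (go k ext int) ≡ length int + k
go-count-I zero    (_ ∷ [])    []          _    = refl
go-count-I zero    []          (_ ∷ [])    _    = refl
go-count-I zero    (x ∷ ext)   (y ∷ int)   size = contradiction size (nonempty-queues-size≢1 x ext y int)
go-count-I zero    (_ ∷ _ ∷ _) []          ()
go-count-I zero    []          (_ ∷ _ ∷ _) ()
go-count-I (suc k) ext         int         size = begin
  count I (go (suc k) ext int)                               ≡⟨ count-unfold I ⟩
  δ I first + (δ I second + count I rest)
    ≡⟨ cong (λ c → δ I first + (δ I second + c)) (go-count-I k ext′ _ (size-rest size)) ⟩
  δ I first + (δ I second + (length (int′ ∷ʳ merged) + k))
    ≡⟨ cong (λ c → δ I first + (δ I second + (c + k))) (length-++ int′) ⟩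
  δ I first + (δ I second + ((length int′ + 1) + k))         ≡⟨ regroup (δ I first) (δ I second) (length int′) k ⟩
  δ I first + (δ I second + length int′) + suc k             ≡⟨ cong (_+ suc k) (sym length-int) ⟩
  length int + suc k                                         ∎
  where
  open Merge (go-merge k ext int size)
  open ≡-Reasoning
  regroup : ∀ a b i k → a + (b + ((i + 1) + k)) ≡ a + (b + i) + suc k
  regroup = solve-∀

go-ends-with-I : ∀ k ext int → length ext + length int ≡ suc k → 1 ≤ length int →
  ∃ λ xs → go k ext int ≡ xs ∷ʳ I
go-ends-with-I zero    []        (_ ∷ [])    _    _ = [] , refl
go-ends-with-I zero    (x ∷ ext) (y ∷ int)   size _ = contradiction size (nonempty-queues-size≢1 x ext y int)
go-ends-with-I zero    []        (_ ∷ _ ∷ _) ()   _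
go-ends-with-I zero    _         []          _    ()
go-ends-with-I (suc k) ext int size _ =
  map (λ xs → first ∷ second ∷ xs) (λ rest≡xs∷ʳI → trans unfold (cong (λ r → first ∷ second ∷ r) rest≡xs∷ʳI))
      (go-ends-with-I k ext′ (int′ ∷ʳ merged) (size-rest size) (≤-trans (m≤n+m 1 _) (≤-reflexive (sym (length-++ int′)))))
  where open Merge (go-merge k ext int size)

sort-length : ∀ {n} (W : Vec ℚ n) → length (sort (toList W)) ≡ n
sort-length W = trans (↭-length (sort-↭ (toList W))) (length-toList W)

signature-first-merge : ∀ {m} (W : Vec ℚ (suc (suc m))) →
  ∃ λ ext → ∃ λ w → length ext ≡ m × signature W ≡ E ∷ E ∷ go m ext [ w ]
signature-first-merge W with sort (toList W) | sort-length W
... | x ∷ y ∷ ext | size = ext , x Q.+ y , suc-injective (suc-injective size) , refl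

first-merge-size : ∀ {m} (ext : List ℚ) (w : ℚ) → length ext ≡ m → length ext + length [ w ] ≡ suc m
first-merge-size ext w refl = +-comm (length ext) 1

signature-count-E : ∀ {m} (W : Vec ℚ (suc (suc m))) → count E (signature W) ≡ suc (suc m)
signature-count-E {m} W with signature-first-merge W
... | ext , w , length-ext , sig≡ rewrite sig≡ =
  cong (λ c → suc (suc c)) (trans (go-count-E m ext [ w ] (first-merge-size ext w length-ext)) length-ext)

signature-count-I : ∀ {m} (W : Vec ℚ (suc (suc m))) → count I (signature W) ≡ suc m
signature-count-I {m} W with signature-first-merge W
... | ext , w , length-ext , sig≡ rewrite sig≡ = go-count-I m ext [ w ] (first-merge-size ext w length-ext)

signature-shape : ∀ {m} (W : Vec ℚ (suc (suc m))) → ∃ λ xs → signature W ≡ E ∷ (E ∷ xs) ∷ʳ I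
signature-shape {m} W with signature-first-merge W
... | ext , w , length-ext , sig≡ =
  map₂ (λ rest≡xs∷ʳI → trans sig≡ (cong (λ r → E ∷ E ∷ r) rest≡xs∷ʳI))
      (go-ends-with-I m ext [ w ] (first-merge-size ext w length-ext) (s≤s z≤n))

EI-IE-balance : ∀ xs → count2 E I (E ∷ xs ∷ʳ I) ≡ count2 I E (E ∷ xs ∷ʳ I) + 1
EI-IE-balance xs = trans (sym (+-identityʳ _)) (count2-EI+δ-last≡count2-IE+δ-head E xs I)

-- The weights need not be positive: the shape of the signature does not depend on them.
mainTheorem2 : (m : ℕ) → (W : Vec ℚ (suc (suc m))) →
    (∀ i → Positive (lookup W i)) →
      (count E (signature W) ≡ suc (suc m))
    × (count I (signature W) ≡ suc m)
    × (length (signature W) ≡ suc m + suc (suc m))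
    × (∃ λ rest → signature W ≡ E ∷ E ∷ rest)
    × (last (signature W) ≡ just I)
    × (count2 E I (signature W) ≡ count2 I E (signature W) + 1)
    × (1 ≤ count2 E I (signature W) × count2 E I (signature W) ≤ suc m)
mainTheorem2 m W _
  with signature W | signature-count-E W | signature-count-I W | signature-shape W
... | .(E ∷ (E ∷ xs) ∷ʳ I) | #E | #I | xs , refl =
  #E , #I , length-signature , (xs ∷ʳ I , refl) , last-∷ʳ (E ∷ E ∷ xs) I ,
  balance , subst (1 ≤_) (sym balance) (m≤n+m 1 _) , ≤-trans (count2-EI≤count-I E ((E ∷ xs) ∷ʳ I)) (≤-reflexive #I)
  where
  balance : count2 E I (E ∷ (E ∷ xs) ∷ʳ I) ≡ count2 I E (E ∷ (E ∷ xs) ∷ʳ I) + 1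
  balance = EI-IE-balance (E ∷ xs)
  length-signature : length (E ∷ (E ∷ xs) ∷ʳ I) ≡ suc m + suc (suc m)
  length-signature = trans (length≡count-E+count-I (E ∷ (E ∷ xs) ∷ʳ I)) (trans (cong₂ _+_ #E #I) (+-comm (suc (suc m)) (suc m)))
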